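{- Let $\mathcal{M}$ be a nonstandard model of $\mathsf{PA}$ and let $\mathcal{U},\mathcal{V}$ be ultrafilters of $\mathrm{SSy}(\mathcal{M})$. Then $\mathcal{U}\leq^{\mathcal{M}}_{\mathsf{RK}}\mathcal{V}$ iff there is an elementary embedding of $\mathcal{M}^\omega/\mathcal{U}$ into $\mathcal{M}^\omega/\mathcal{V}$ fixing $M$ pointwise.
   Context: $\mathrm{Def}(\mathcal{M})$ is the set of parametrically definable subsets of $M$; $\mathrm{SSy}(\mathcal{M})=\{X\cap\omega:X\in\mathrm{Def}(\mathcal{M})\}$, and ultrafilters of $\mathrm{SSy}(\mathcal{M})$ are ultrafilters of this Boolean algebra. $\mathcal{U}\leq^{\mathcal{M}}_{\mathsf{RK}}\mathcal{V}$ means there is an $\mathcal{M}$-definable $t:M\to M$ such that whenever $X\in\mathrm{Def}(\mathcal{M})$ and $X\cap\omega\in\mathcal{U}$, then $t^{ -1}(X)\cap\omega\in\mathcal{V}$. For an ultrafilter $\mathcal{U}$ of $\mathrm{SSy}(\mathcal{M})$: with $T$ the set of $\mathcal{M}$-definable functions $t:M\to M$, $t_1\sim t_2$ iff $\{n<\omega:t_1(n)=t_2(n)\}\in\mathcal{U}$, and $[t]$ the class of $t$, $\mathcal{M}^\omega/\mathcal{U}$ is the structure with domain $\{[t]:t\in T\}$ satisfying $\mathcal{M}^\omega/\mathcal{U}\models\varphi([t_0],\dots,[t_{j-1}])$ iff $\{n<\omega:\mathcal{M}\models\varphi(t_0(n),\dots,t_{j-1}(n))\}\in\mathcal{U}$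 for every formula $\varphi$; $a\in M$ is identified with the class of the constant function with value $a$. -}

module Defs where

open import Data.Nat using (ℕ; zero; suc)
open import Data.Product using (Σ; _×_; _,_)
open import Data.Sum using (_⊎_)
open import Data.Empty using (⊥)
open import Data.Unit using (⊤)
open import Relation.Nullary using (¬_)
open import Relation.Binary.PropositionalEquality using (_≡_; _≢_; refl; sym)
open import Function.Bundles using (_⇔_; mk⇔)

data Term : Set where
  var  : ℕ → Term
  zero' : Term
  suc'  : Term → Term
  _+'_  : Term → Term → Term
  _*'_  : Term → Term → Term

data Formula : Set where
  _≐_  : Term → Term → Formula
  ⊥'   : Formula
  _∧'_ : Formula → Formula → Formula
  _∨'_ : Formula → Formula → Formula
  _⇒'_ : Formula → Formula → Formula
  ∀'   : Formula → Formula
  ∃'   : Formula → Formula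

-- L-structures (equality is interpreted as true equality)
record Structure : Set₁ where
  field
    Carrier : Set
    z   : Carrier
    s   : Carrier → Carrier
    add : Carrier → Carrier → Carrier
    mul : Carrier → Carrier → Carrier

module _ (M : Structure) where
  open Structure M

  Assignment : Set
  Assignment = ℕ → Carrier

  _∷ₐ_ : Carrier → Assignment → Assignment
  (a ∷ₐ ρ) zero = a
  (a ∷ₐ ρ) (suc i) = ρ i

  evalT : Term → Assignment → Carrier
  evalT (var i) ρ = ρ i
  evalT zero' ρ = z
  evalT (suc' t) ρ = s (evalT t ρ)
  evalT (t +' u) ρ = add (evalT t ρ) (evalT u ρ)
  evalT (t *' u) ρ = mul (evalT t ρ) (evalT u ρ)

  Sat : Formula → Assignment → Set
  Sat (t ≐ u) ρ = evalT t ρ ≡ evalT u ρ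
  Sat ⊥' ρ = ⊥
  Sat (φ ∧' ψ) ρ = Sat φ ρ × Sat ψ ρ
  Sat (φ ∨' ψ) ρ = Sat φ ρ ⊎ Sat ψ ρ
  Sat (φ ⇒' ψ) ρ = Sat φ ρ → Sat ψ ρ
  Sat (∀' φ) ρ = (a : Carrier) → Sat φ (a ∷ₐ ρ)
  Sat (∃' φ) ρ = Σ Carrier λ a → Sat φ (a ∷ₐ ρ)

  num : ℕ → Carrier
  num zero = z
  num (suc n) = s (num n)

  record IsPAModel : Set where
    field
      s≢z    : ∀ a → s a ≢ z
      s-inj  : ∀ a b → s a ≡ s b → a ≡ b
      add-z  : ∀ a → add a z ≡ a
      add-s  : ∀ a b → add a (s b) ≡ s (add a b)
      mul-z  : ∀ a → mul a z ≡ z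
      mul-s  : ∀ a b → mul a (s b) ≡ add (mul a b) a
      induction : (φ : Formula) (ρ : Assignment) →
        Sat φ (z ∷ₐ ρ) →
        ((a : Carrier) → Sat φ (a ∷ₐ ρ) → Sat φ (s a ∷ₐ ρ)) →
        (a : Carrier) → Sat φ (a ∷ₐ ρ)

  Nonstandard : Set
  Nonstandard = Σ Carrier λ c → (n : ℕ) → c ≢ num n

  Definable : (Carrier → Set) → Set
  Definable X = Σ Formula λ φ → Σ Assignment λ ρ →
    (a : Carrier) → X a ⇔ Sat φ (a ∷ₐ ρ)

  -- SSy(M) = { X ∩ ω : X ∈ Def(M) }, as subsets of ℕ
  SSy : (ℕ → Set) → Set₁
  SSy A = Σ (Carrier → Set) λ X → Definable X × ((n : ℕ) → A n ⇔ X (num n))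

  record IsUltrafilter (U : (ℕ → Set) → Set) : Set₁ where
    field
      ⊆SSy    : ∀ A → U A → SSy A
      full    : U (λ _ → ⊤)
      no-empty : ¬ U (λ _ → ⊥)
      up      : ∀ A B → U A → SSy B → (∀ n → A n → B n) → U B
      meet    : ∀ A B → U A → U B → U (λ n → A n × B n)
      ultra   : ∀ A → SSy A → U A ⊎ U (λ n → ¬ A n)

  record DefFun : Set where
    field
      fun : Carrier → Carrier
      graph : Formula
      params : Assignment
      defines : (a b : Carrier) → Sat graph (a ∷ₐ (b ∷ₐ params)) ⇔ fun a ≡ b
  open DefFun public

  constF : Carrier → DefFun
  constF a = record
    { fun = λ _ → a
    ; graph = var 1 ≐ var 2
    ; params = λ _ → a
    ; defines = λ x b → mk⇔ sym sym }

  _≤RK_ : ((ℕ → Set) → Set) → ((ℕ → Set) → Set) → Set₁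
  U ≤RK V = Σ DefFun λ t → (X : Carrier → Set) → Definable X →
    U (λ n → X (num n)) → V (λ n → X (fun t (num n)))

  -- the ultrapower M^ω/U: domain = DefFun modulo ~U, satisfaction by the Łoś clause
  module Ultrapower (U : (ℕ → Set) → Set) where
    _~_ : DefFun → DefFun → Set
    t₁ ~ t₂ = U (λ n → fun t₁ (num n) ≡ fun t₂ (num n))

    SatU : Formula → (ℕ → DefFun) → Set
    SatU φ τ = U (λ n → Sat φ (λ i → fun (τ i) (num n)))

  -- elementary embedding M^ω/U → M^ω/V fixing M pointwise
  -- (a map on representatives respecting the quotients)
  ElemEmbFixingM : ((ℕ → Set) → Set) → ((ℕ → Set) → Set) → Set
  ElemEmbFixingM U V =
    Σ (DefFun → DefFun) λ j →
      ((t₁ t₂ : DefFun) → t₁ ~U t₂ → j t₁ ~V j t₂) ×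
      ((φ : Formula) (τ : ℕ → DefFun) → SatU.SatU φ τ ⇔ SatV.SatU φ (λ i → j (τ i))) ×
      ((a : Carrier) → j (constF a) ~V constF a)
    where
      module SatU = Ultrapower U
      module SatV = Ultrapower V
      _~U_ = Ultrapower._~_ U
      _~V_ = Ultrapower._~_ V

-- If t witnesses U ≤RK V, then [s] ↦ [s ∘ t] is an elementary embedding fixing M:
-- for every formula φ and definable functions τ the set {a | M ⊨ φ[τ(a)]} is
-- definable, so the Rudin–Keisler condition carries it from U to V, and since U is
-- an ultrafilter and V is proper it also carries it back. Conversely, an elementary
-- embedding j fixing M yields t = j[id]: if X is defined by φ with parameters ρ, Łoś
-- applied to φ[id, ρ] carries X from U to V, because j fixes the finitely many
-- parameters that actually occur in φ.
{-# OPTIONS --safe #-}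
module Submission where

open import Defs
open import Data.Nat using (ℕ; zero; suc; _+_; _<_; _⊔_; pred; s≤s)
open import Data.Nat.Properties using (m≤m⊔n; m≤n⊔m; <-≤-trans; <-trans; n<1+n; m<n⇒m<1+n; m<1+n⇒m<n∨m≡n)
open import Data.Product using (Σ; _×_; _,_)
open import Data.Product.Function.NonDependent.Propositional using (_×-⇔_)
open import Data.Product.Function.Dependent.Propositional using (Σ-⇔)
open import Data.Sum using (inj₁; inj₂)
open import Data.Sum.Function.Propositional using (_⊎-⇔_)
open import Data.Empty using (⊥; ⊥-elim)
open import Data.Unit using (⊤; tt)
open import Data.Vec using (Vec; []; _∷_)
open import Relation.Nullary using (¬_)
open import Relation.Binary.PropositionalEquality using (_≡_; _≗_; refl; sym; trans; cong; cong₂)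
open import Function.Base using (_∘_)
open import Function.Bundles using (_⇔_; mk⇔; Equivalence)
open import Function.Construct.Identity using (↠-id)
open import Function.Properties.Equivalence using () renaming (refl to ⇔-refl; sym to ⇔-sym; trans to ⇔-trans)
open import Function.Related.TypeIsomorphisms using (→-cong-⇔; ¬-cong-⇔)

open Equivalence using (to; from)

∀-⇔ : {A : Set} {P Q : A → Set} → (∀ a → P a ⇔ Q a) → (∀ a → P a) ⇔ (∀ a → Q a)
∀-⇔ P⇔Q = mk⇔ (λ p a → to (P⇔Q a) (p a)) (λ q a → from (P⇔Q a) (q a))

≡-cong-⇔ : {A : Set} {a a′ b b′ : A} → a ≡ a′ → b ≡ b′ → (a ≡ b) ⇔ (a′ ≡ b′)
≡-cong-⇔ refl refl = ⇔-refl

All< : ℕ → (ℕ → Set) → Set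
All< zero P = ⊤
All< (suc k) P = P k × All< k P

All<⇔ : ∀ {k P} → All< k P ⇔ (∀ i → i < k → P i)
All<⇔ = mk⇔ lookup tabulate
  where
  lookup : ∀ {k P} → All< k P → ∀ i → i < k → P i
  lookup {suc k} (p , ps) i i<1+k with m<1+n⇒m<n∨m≡n i<1+k
  ... | inj₁ i<k = lookup ps i i<k
  ... | inj₂ refl = p
  tabulate : ∀ {k P} → (∀ i → i < k → P i) → All< k P
  tabulate {zero} f = tt
  tabulate {suc k} f = f k (n<1+n k) , tabulate (λ i i<k → f i (m<n⇒m<1+n i<k))

_◂_ : {A : Set} → A → (ℕ → A) → ℕ → A
(a ◂ as) zero = a
(a ◂ as) (suc i) = as i

_≈[_]_ : {A : Set} → (ℕ → A) → ℕ → (ℕ → A) → Set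
ρ ≈[ k ] σ = ∀ i → i < k → ρ i ≡ σ i

≈-⊔ˡ : ∀ {A : Set} {ρ σ : ℕ → A} {m n} → ρ ≈[ m ⊔ n ] σ → ρ ≈[ m ] σ
≈-⊔ˡ h i i<m = h i (<-≤-trans i<m (m≤m⊔n _ _))

≈-⊔ʳ : ∀ {A : Set} {ρ σ : ℕ → A} {m n} → ρ ≈[ m ⊔ n ] σ → ρ ≈[ n ] σ
≈-⊔ʳ h i i<n = h i (<-≤-trans i<n (m≤n⊔m _ _))

ext : (ℕ → ℕ) → ℕ → ℕ
ext f zero = zero
ext f (suc i) = suc (f i)

renameT : (ℕ → ℕ) → Term → Term
renameT f (var i) = var (f i)
renameT f zero' = zero'
renameT f (suc' t) = suc' (renameT f t)
renameT f (t +' u) = renameT f t +' renameT f u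
renameT f (t *' u) = renameT f t *' renameT f u

rename : (ℕ → ℕ) → Formula → Formula
rename f (t ≐ u) = renameT f t ≐ renameT f u
rename f ⊥' = ⊥'
rename f (φ ∧' ψ) = rename f φ ∧' rename f ψ
rename f (φ ∨' ψ) = rename f φ ∨' rename f ψ
rename f (φ ⇒' ψ) = rename f φ ⇒' rename f ψ
rename f (∀' φ) = ∀' (rename (ext f) φ)
rename f (∃' φ) = ∃' (rename (ext f) φ)

freeBoundT : Term → ℕ
freeBoundT (var i) = suc i
freeBoundT zero' = 0
freeBoundT (suc' t) = freeBoundT t
freeBoundT (t +' u) = freeBoundT t ⊔ freeBoundT u
freeBoundT (t *' u) = freeBoundT t ⊔ freeBoundT u

freeBound : Formula → ℕ
freeBound (t ≐ u) = freeBoundT t ⊔ freeBoundT u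
freeBound ⊥' = 0
freeBound (φ ∧' ψ) = freeBound φ ⊔ freeBound ψ
freeBound (φ ∨' ψ) = freeBound φ ⊔ freeBound ψ
freeBound (φ ⇒' ψ) = freeBound φ ⊔ freeBound ψ
freeBound (∀' φ) = pred (freeBound φ)
freeBound (∃' φ) = pred (freeBound φ)

∃ⁿ : ℕ → Formula → Formula
∃ⁿ zero ψ = ψ
∃ⁿ (suc k) ψ = ∃ⁿ k (∃' ψ)

⋀ : ℕ → (ℕ → Formula) → Formula
⋀ zero G = zero' ≐ zero'
⋀ (suc k) G = G k ∧' ⋀ k G

double : ℕ → ℕ
double zero = zero
double (suc n) = suc (suc (double n))

interleave : {A : Set} → (ℕ → A) → (ℕ → A) → ℕ → A
interleave f g zero = f 0
interleave f g (suc zero) = g 0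
interleave f g (suc (suc m)) = interleave (f ∘ suc) (g ∘ suc) m

interleave-double : ∀ {A : Set} (f g : ℕ → A) j → interleave f g (double j) ≡ f j
interleave-double f g zero = refl
interleave-double f g (suc j) = interleave-double (f ∘ suc) (g ∘ suc) j

interleave-suc-double : ∀ {A : Set} (f g : ℕ → A) j → interleave f g (suc (double j)) ≡ g j
interleave-suc-double f g zero = refl
interleave-suc-double f g (suc j) = interleave-suc-double (f ∘ suc) (g ∘ suc) j

merge : {A : Set} → ℕ → (ℕ → ℕ → A) → ℕ → A
merge zero fs = fs 0
merge (suc k) fs = interleave (fs 0) (merge k (fs ∘ suc))

mergeIndex : ℕ → ℕ → ℕ
mergeIndex zero j = double j
mergeIndex (suc i) j = suc (double (mergeIndex i j))

merge-mergeIndex : ∀ {A : Set} {k i} (fs : ℕ → ℕ → A) j → i < k → merge k fs (mergeIndex i j) ≡ fs i j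
merge-mergeIndex {k = suc k} {zero} fs j _ = interleave-double (fs 0) _ j
merge-mergeIndex {k = suc k} {suc i} fs j (s≤s i<k) =
  trans (interleave-suc-double (fs 0) _ (mergeIndex i j)) (merge-mergeIndex (fs ∘ suc) j i<k)

module _ (M : Structure) where
  open Structure M

  infixr 5 _∷ᶜ_ _++ᶜ_

  _∷ᶜ_ : Carrier → Assignment M → Assignment M
  _∷ᶜ_ = _∷ₐ_ M

  ≈-∷ : ∀ {ρ σ k} a → ρ ≈[ pred k ] σ → (a ∷ᶜ ρ) ≈[ k ] (a ∷ᶜ σ)
  ≈-∷ a h zero _ = refl
  ≈-∷ {k = suc k} a h (suc i) (s≤s i<k) = h i i<k

  evalT-cong : ∀ {ρ σ} t → ρ ≈[ freeBoundT t ] σ → evalT M t ρ ≡ evalT M t σ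
  evalT-cong (var i) h = h i (n<1+n i)
  evalT-cong zero' h = refl
  evalT-cong (suc' t) h = cong s (evalT-cong t h)
  evalT-cong (t +' u) h = cong₂ add (evalT-cong t (≈-⊔ˡ h)) (evalT-cong u (≈-⊔ʳ h))
  evalT-cong (t *' u) h = cong₂ mul (evalT-cong t (≈-⊔ˡ h)) (evalT-cong u (≈-⊔ʳ h))

  Sat-cong : ∀ {ρ σ} φ → ρ ≈[ freeBound φ ] σ → Sat M φ ρ ⇔ Sat M φ σ
  Sat-cong (t ≐ u) h = ≡-cong-⇔ (evalT-cong t (≈-⊔ˡ h)) (evalT-cong u (≈-⊔ʳ h))
  Sat-cong ⊥' h = ⇔-refl
  Sat-cong (φ ∧' ψ) h = Sat-cong φ (≈-⊔ˡ h) ×-⇔ Sat-cong ψ (≈-⊔ʳ h)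
  Sat-cong (φ ∨' ψ) h = Sat-cong φ (≈-⊔ˡ h) ⊎-⇔ Sat-cong ψ (≈-⊔ʳ h)
  Sat-cong (φ ⇒' ψ) h = →-cong-⇔ (Sat-cong φ (≈-⊔ˡ h)) (Sat-cong ψ (≈-⊔ʳ h))
  Sat-cong (∀' φ) h = ∀-⇔ λ a → Sat-cong φ (≈-∷ a h)
  Sat-cong (∃' φ) h = Σ-⇔ (↠-id _) λ {a} → Sat-cong φ (≈-∷ a h)

  Sat-≗ : ∀ {ρ σ} φ → ρ ≗ σ → Sat M φ ρ ⇔ Sat M φ σ
  Sat-≗ φ h = Sat-cong φ (λ i _ → h i)

  ext-∷ : ∀ {ρ σ} f a → ρ ∘ f ≗ σ → (a ∷ᶜ ρ) ∘ ext f ≗ (a ∷ᶜ σ)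
  ext-∷ f a h zero = refl
  ext-∷ f a h (suc i) = h i

  evalT-rename : ∀ {ρ σ} f t → ρ ∘ f ≗ σ → evalT M (renameT f t) ρ ≡ evalT M t σ
  evalT-rename f (var i) h = h i
  evalT-rename f zero' h = refl
  evalT-rename f (suc' t) h = cong s (evalT-rename f t h)
  evalT-rename f (t +' u) h = cong₂ add (evalT-rename f t h) (evalT-rename f u h)
  evalT-rename f (t *' u) h = cong₂ mul (evalT-rename f t h) (evalT-rename f u h)

  Sat-rename : ∀ {ρ σ} f φ → ρ ∘ f ≗ σ → Sat M (rename f φ) ρ ⇔ Sat M φ σ
  Sat-rename f (t ≐ u) h = ≡-cong-⇔ (evalT-rename f t h) (evalT-rename f u h)
  Sat-rename f ⊥' h = ⇔-refl
  Sat-rename f (φ ∧' ψ) h = Sat-rename f φ h ×-⇔ Sat-rename f ψ h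
  Sat-rename f (φ ∨' ψ) h = Sat-rename f φ h ⊎-⇔ Sat-rename f ψ h
  Sat-rename f (φ ⇒' ψ) h = →-cong-⇔ (Sat-rename f φ h) (Sat-rename f ψ h)
  Sat-rename f (∀' φ) h = ∀-⇔ λ a → Sat-rename (ext f) φ (ext-∷ f a h)
  Sat-rename f (∃' φ) h = Σ-⇔ (↠-id _) λ {a} → Sat-rename (ext f) φ (ext-∷ f a h)

  Sat-rename-graph : ∀ (t : DefFun M) f {ρ a b} → ρ (f 0) ≡ a → ρ (f 1) ≡ b →
    (∀ j → ρ (f (suc (suc j))) ≡ params t j) →
    Sat M (rename f (graph t)) ρ ⇔ (fun t a ≡ b)
  Sat-rename-graph t f {ρ} {a} {b} ρf0≡a ρf1≡b ρf≡params =
    ⇔-trans (Sat-rename f (graph t) ρ∘f≗) (defines t a b)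
    where
    ρ∘f≗ : ρ ∘ f ≗ (a ∷ᶜ b ∷ᶜ params t)
    ρ∘f≗ zero = ρf0≡a
    ρ∘f≗ (suc zero) = ρf1≡b
    ρ∘f≗ (suc (suc j)) = ρf≡params j

  _++ᶜ_ : ∀ {k} → Vec Carrier k → Assignment M → Assignment M
  [] ++ᶜ ρ = ρ
  (x ∷ xs) ++ᶜ ρ = x ∷ᶜ (xs ++ᶜ ρ)

  ++ᶜ-drop : ∀ {k} (xs : Vec Carrier k) ρ j → (xs ++ᶜ ρ) (k + j) ≡ ρ j
  ++ᶜ-drop [] ρ j = refl
  ++ᶜ-drop (x ∷ xs) ρ j = ++ᶜ-drop xs ρ j

  prefix : ∀ k → Assignment M → Vec Carrier k
  prefix zero g = []
  prefix (suc k) g = g 0 ∷ prefix k (g ∘ suc)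

  ++ᶜ-prefix : ∀ {k} g ρ → (prefix k g ++ᶜ ρ) ≈[ k ] g
  ++ᶜ-prefix {suc k} g ρ zero _ = refl
  ++ᶜ-prefix {suc k} g ρ (suc i) (s≤s i<k) = ++ᶜ-prefix (g ∘ suc) ρ i i<k

  Sat-∃ⁿ : ∀ k ψ ρ → Sat M (∃ⁿ k ψ) ρ ⇔ Σ (Vec Carrier k) λ xs → Sat M ψ (xs ++ᶜ ρ)
  Sat-∃ⁿ zero ψ ρ = mk⇔ (λ p → [] , p) λ { ([] , p) → p }
  Sat-∃ⁿ (suc k) ψ ρ = ⇔-trans (Sat-∃ⁿ k (∃' ψ) ρ)
    (mk⇔ (λ { (xs , a , p) → a ∷ xs , p }) λ { (a ∷ xs , p) → xs , a , p })

  Sat-⋀ : ∀ k G ρ → Sat M (⋀ k G) ρ ⇔ All< k (λ i → Sat M (G i) ρ)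
  Sat-⋀ zero G ρ = mk⇔ (λ _ → tt) (λ _ → refl)
  Sat-⋀ (suc k) G ρ = ⇔-refl ×-⇔ Sat-⋀ k G ρ

  evalAt : (ℕ → DefFun M) → Carrier → Assignment M
  evalAt τ a i = fun (τ i) a

  evalAt-◂ : ∀ t τ a → (fun t a ∷ᶜ evalAt τ a) ≗ evalAt (t ◂ τ) a
  evalAt-◂ t τ a zero = refl
  evalAt-◂ t τ a (suc i) = refl

  -- The values τ i a (i < k) become the existentially quantified variables 0 … k-1, each
  -- pinned down by the graph of τ i; variable k holds a, followed by the merged parameters.
  pullback-definable : ∀ φ τ → Definable M (λ a → Sat M φ (evalAt τ a))
  pullback-definable φ τ = ∃ⁿ k (⋀ k G ∧' φ) , P , λ a → ⇔-sym (⇔-trans (Sat-∃ⁿ k _ (a ∷ᶜ P)) (witnesses a))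
    where
    k = freeBound φ
    P = merge k (λ i → params (τ i))
    graphVars : ℕ → ℕ → ℕ
    graphVars i zero = k + 0
    graphVars i (suc zero) = i
    graphVars i (suc (suc j)) = k + suc (mergeIndex i j)
    G : ℕ → Formula
    G i = rename (graphVars i) (graph (τ i))
    Sat-G : ∀ a (xs : Vec Carrier k) {i} → i < k → Sat M (G i) (xs ++ᶜ a ∷ᶜ P) ⇔ (fun (τ i) a ≡ (xs ++ᶜ a ∷ᶜ P) i)
    Sat-G a xs {i} i<k = Sat-rename-graph (τ i) (graphVars i) (++ᶜ-drop xs _ 0) refl
      (λ j → trans (++ᶜ-drop xs _ (suc (mergeIndex i j))) (merge-mergeIndex _ j i<k))
    graphs⇔agree : ∀ a xs → Sat M (⋀ k G) (xs ++ᶜ a ∷ᶜ P) ⇔ (evalAt τ a ≈[ k ] (xs ++ᶜ a ∷ᶜ P))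
    graphs⇔agree a xs = ⇔-trans (Sat-⋀ k G _) (⇔-trans All<⇔ (mk⇔
      (λ gs i i<k → to (Sat-G a xs i<k) (gs i i<k))
      (λ eqs i i<k → from (Sat-G a xs i<k) (eqs i i<k))))
    witnesses : ∀ a → (Σ (Vec Carrier k) λ xs → Sat M (⋀ k G ∧' φ) (xs ++ᶜ a ∷ᶜ P)) ⇔ Sat M φ (evalAt τ a)
    witnesses a = mk⇔
      (λ { (xs , gs , sφ) → from (Sat-cong φ (to (graphs⇔agree a xs) gs)) sφ })
      (λ sφ → xs , from (graphs⇔agree a xs) (λ i i<k → sym (agree i i<k)) , from (Sat-cong φ agree) sφ)
      where
      xs = prefix k (evalAt τ a)
      agree = ++ᶜ-prefix (evalAt τ a) (a ∷ᶜ P)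

  equalizer-definable : ∀ t₁ t₂ → Definable M (λ a → fun t₁ a ≡ fun t₂ a)
  equalizer-definable t₁ t₂ = pullback-definable (var 0 ≐ var 1) (t₁ ◂ λ _ → t₂)

  definable-⇔ : ∀ {X Y} → Definable M X → (∀ a → X a ⇔ Y a) → Definable M Y
  definable-⇔ (φ , ρ , X⇔φ) X⇔Y = φ , ρ , λ a → ⇔-trans (⇔-sym (X⇔Y a)) (X⇔φ a)

  definable-¬ : ∀ {X} → Definable M X → Definable M (¬_ ∘ X)
  definable-¬ (φ , ρ , X⇔φ) = (φ ⇒' ⊥') , ρ , λ a → ¬-cong-⇔ (X⇔φ a)

  definable-⊥ : Definable M (λ _ → ⊥)
  definable-⊥ = ⊥' , (λ _ → z) , λ _ → ⇔-refl

  definable-everywhere : ∀ {X} → (∀ a → X a) → Definable M X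
  definable-everywhere x = (zero' ≐ zero') , (λ _ → z) , λ a → mk⇔ (λ _ → refl) (λ _ → x a)

  definable⇒SSy : ∀ {X} → Definable M X → SSy M (λ n → X (num M n))
  definable⇒SSy {X} dX = X , dX , λ _ → ⇔-refl

  idF : DefFun M
  idF = record { fun = λ a → a ; graph = var 0 ≐ var 1 ; params = λ _ → z ; defines = λ _ _ → ⇔-refl }

  -- Under the ∃' the variables are: 0 the intermediate value, 1 the argument, 2 the value,
  -- and from 3 on the interleaved parameters of f (even slots) and g (odd slots).
  _∘ᶠ_ : DefFun M → DefFun M → DefFun M
  g ∘ᶠ f = record
    { fun = λ a → fun g (fun f a)
    ; graph = ∃' (rename inner (graph f) ∧' rename outer (graph g))
    ; params = P
    ; defines = λ a b → ⇔-trans (Σ-⇔ (↠-id _) (graphs a b)) (mk⇔ (λ { (_ , refl , e) → e }) (λ e → _ , refl , e))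
    }
    where
    P = interleave (params f) (params g)
    inner outer : ℕ → ℕ
    inner zero = 1
    inner (suc zero) = 0
    inner (suc (suc j)) = 3 + double j
    outer zero = 0
    outer (suc zero) = 2
    outer (suc (suc j)) = 3 + suc (double j)
    graphs : ∀ a b {c} → Sat M (rename inner (graph f) ∧' rename outer (graph g)) (c ∷ᶜ a ∷ᶜ b ∷ᶜ P)
                       ⇔ (fun f a ≡ c × fun g c ≡ b)
    graphs a b = Sat-rename-graph f inner refl refl (interleave-double (params f) (params g))
           ×-⇔ Sat-rename-graph g outer refl refl (interleave-suc-double (params f) (params g))

  definable-∘ : ∀ {X} → Definable M X → (t : DefFun M) → Definable M (X ∘ fun t)
  definable-∘ (φ , ρ , X⇔φ) t = definable-⇔ (pullback-definable φ τ)
    λ a → ⇔-sym (⇔-trans (X⇔φ (fun t a)) (Sat-≗ φ (evalAt-◂ t (constF M ∘ ρ) a)))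
    where
    τ = t ◂ (constF M ∘ ρ)

  module UltrafilterProperties {U} (uU : IsUltrafilter M U) where
    open IsUltrafilter uU

    disjoint : ∀ {A} → U A → U (¬_ ∘ A) → ⊥
    disjoint uA u¬A = no-empty (up _ _ (meet _ _ uA u¬A) (definable⇒SSy definable-⊥) λ _ (a , ¬a) → ¬a a)

    meet-All< : ∀ k (P : ℕ → ℕ → Set) → (∀ i → U (P i)) → U (λ n → All< k (λ i → P i n))
    meet-All< zero P uP = full
    meet-All< (suc k) P uP = meet _ _ (uP k) (meet-All< k P uP)

    ~-refl : ∀ t → Ultrapower._~_ M U t t
    ~-refl t = up _ _ full (definable⇒SSy (definable-everywhere {λ a → fun t a ≡ fun t a} λ _ → refl)) λ _ _ → refl

  module _ {U V} (uU : IsUltrafilter M U) (uV : IsUltrafilter M V) where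
    open IsUltrafilter
    open UltrafilterProperties

    ≤RK-reflects : ∀ ((t , _) : _≤RK_ M U V) {X} → Definable M X →
      V (λ n → X (fun t (num M n))) → U (λ n → X (num M n))
    ≤RK-reflects (t , rk) dX vXt with ultra uU _ (definable⇒SSy dX)
    ... | inj₁ uX = uX
    ... | inj₂ u¬X = ⊥-elim (disjoint uV vXt (rk _ (definable-¬ dX) u¬X))

    ≤RK⇒embedding : _≤RK_ M U V → ElemEmbFixingM M U V
    ≤RK⇒embedding (t , rk) =
      (_∘ᶠ t) ,
      (λ t₁ t₂ → rk _ (equalizer-definable t₁ t₂)) ,
      (λ φ τ → mk⇔ (rk _ (pullback-definable φ τ)) (≤RK-reflects (t , rk) (pullback-definable φ τ))) ,
      (λ a → ~-refl uV (constF M a))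

    embedding⇒≤RK : ElemEmbFixingM M U V → _≤RK_ M U V
    embedding⇒≤RK (j , _ , elementary , fixes) = t , transfer
      where
      t = j idF
      transfer : (X : Carrier → Set) → Definable M X → U (λ n → X (num M n)) → V (λ n → X (fun t (num M n)))
      transfer X dX@(φ , ρ , X⇔φ) uX =
        up uV _ _ (meet uV _ _ vφ parameters-fixed) (definable⇒SSy (definable-∘ dX t)) conclude
        where
        k = freeBound φ
        τ = idF ◂ (constF M ∘ ρ)
        uφ : U (λ n → Sat M φ (evalAt τ (num M n)))
        uφ = up uU _ _ uX (definable⇒SSy (pullback-definable φ τ))
          λ n x → to (Sat-≗ φ (evalAt-◂ idF (constF M ∘ ρ) (num M n))) (to (X⇔φ _) x)
        vφ : V (λ n → Sat M φ (evalAt (j ∘ τ) (num M n)))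
        vφ = to (elementary φ τ) uφ
        parameters-fixed : V (λ n → All< k (λ i → fun (j (constF M (ρ i))) (num M n) ≡ ρ i))
        parameters-fixed = meet-All< uV k _ (fixes ∘ ρ)
        conclude : ∀ n → Sat M φ (evalAt (j ∘ τ) (num M n)) × All< k (λ i → fun (j (constF M (ρ i))) (num M n) ≡ ρ i) →
          X (fun t (num M n))
        conclude n (sφ , fixed) = from (X⇔φ _) (to (Sat-cong φ agree) sφ)
          where
          agree : evalAt (j ∘ τ) (num M n) ≈[ k ] (fun t (num M n) ∷ᶜ ρ)
          agree zero _ = refl
          agree (suc i) i+1<k = to All<⇔ fixed i (<-trans (n<1+n i) i+1<k)

lemma2p6 : (M : Structure) → IsPAModel M → Nonstandard M →
    (U V : (ℕ → Set) → Set) →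
    IsUltrafilter M U → IsUltrafilter M V →
    (_≤RK_ M U V ⇔ ElemEmbFixingM M U V)
lemma2p6 M _ _ U V uU uV = mk⇔ (≤RK⇒embedding M uU uV) (embedding⇒≤RK M uU uV)
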